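{- Let $a<b$ be coprime positive integers and let $S(a,b)=\{\lfloor ib/a\rfloor : 1\le i<a\}$. A diagonal of the convex $(b+1)$-gon $\mathbb{P}_{b+1}$ which separates $i$ vertices from $b-i-1$ vertices appears as a vertex of the simplicial complex $\mathsf{Ass}(a,b)$ (i.e., belongs to some facet) if and only if $i\in S(a,b)$.
   Context: An $(a,b)$-Dyck path is a lattice path from $(0,0)$ to $(b,a)$ with unit north and east steps that stays above the line $y=\frac{a}{b}x$ (meeting it only at its endpoints). For such a path $D$ and a lattice point $P\neq(0,0)$ of $D$ which is the bottom of a north step, the laser $\ell(P)$ is the segment of slope $a/b$ from $P$ going northeast up to the first point beyond $P$ where it meets $D$; this endpoint lies in the interior of an east step of $D$ whose right endpoint is called $Q$. Label the vertices of $\mathbb{P}_{b+1}$ by $1,\dots,b+1$ clockwise and let $e(P)$ be the diagonal joining vertices $i+1$ and $j+1$ where $i,j$ are the $x$-coordinates of $P,Q$. Let $F(D)=\{e(P)\}$ over all such $P$. $\mathsf{Ass}(a,b)$ is the simplicial complex whose facets are the sets $F(D)$ for all $(a,b)$-Dyck paths $D$. -}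

module Defs where

open import Data.Nat using (ℕ; zero; suc; _+_; _*_; _∸_; _≤_; _<_; NonZero)
open import Data.Nat.DivMod using (_/_)
open import Data.List using (List; []; _∷_; length; take; drop)
open import Data.Product using (_×_; ∃-syntax; Σ-syntax)
open import Data.Sum using (_⊎_)
open import Relation.Binary.PropositionalEquality using (_≡_)
open import Relation.Nullary using (¬_)

data Step : Set where
  N E : Step

#N : List Step → ℕ
#N []       = 0
#N (N ∷ s)  = suc (#N s)
#N (E ∷ s)  = #N s

#E : List Step → ℕ
#E []       = 0
#E (N ∷ s)  = #E s
#E (E ∷ s)  = suc (#E s)

posX : List Step → ℕ → ℕ
posX D k = #E (take k D)

posY : List Step → ℕ → ℕ
posY D k = #N (take k D)

-- An (a,b)-Dyck path: a lattice path from (0,0) to (b,a) with unit N/E steps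
-- all of whose lattice points other than the two endpoints lie strictly above
-- the line y = (a/b) x, i.e. a*x < b*y.
IsDyck : ℕ → ℕ → List Step → Set
IsDyck a b D =
  (#N D ≡ a) × (#E D ≡ b) ×
  (∀ k → 0 < k → k < length D → a * posX D k < b * posY D k)

-- The k-th step (0-indexed) of D is a north step, i.e. the point after k
-- steps is the bottom of a north step.
NorthAt : List Step → ℕ → Set
NorthAt D k = take 1 (drop k D) ≡ N ∷ []

LaserPoint : List Step → ℕ → Set
LaserPoint D k =
  k < length D × NorthAt D k × ¬ ((posX D k ≡ 0) × (posY D k ≡ 0))

-- The lattice point pos m lies on or to the right of (below) the line of slope
-- a/b through pos k:  b*y_m - a*x_m ≤ b*y_k - a*x_k  (written in ℕ).
OnOrBelowLaser : ℕ → ℕ → List Step → ℕ → ℕ → Set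
OnOrBelowLaser a b D k m =
  b * posY D m + a * posX D k ≤ b * posY D k + a * posX D m

-- The laser first meets D again on the step from pos (m-1) to pos m, where m
-- is the first index after k whose lattice point is on or below the laser line;
-- Q = pos m is the right endpoint of that (east) step.
LaserEnd : ℕ → ℕ → List Step → ℕ → ℕ → Set
LaserEnd a b D k m =
  k < m × m ≤ length D × OnOrBelowLaser a b D k m ×
  (∀ m′ → k < m′ → m′ < m → ¬ OnOrBelowLaser a b D k m′)

SameDiagonal : ℕ → ℕ → ℕ → ℕ → Set
SameDiagonal i j u v = ((u ≡ i + 1) × (v ≡ j + 1)) ⊎ ((u ≡ j + 1) × (v ≡ i + 1))

IsAssVertex : ℕ → ℕ → ℕ → ℕ → Set
IsAssVertex a b u v =
  ∃[ D ] (IsDyck a b D ×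
    ∃[ k ] ∃[ m ] (LaserPoint D k × LaserEnd a b D k m ×
                   SameDiagonal (posX D k) (posX D m) u v))

-- {u,v} (with u < v) is a diagonal of the convex (b+1)-gon with vertices
-- labelled 1, …, b+1 clockwise: the endpoints are not adjacent.
IsDiagonal : ℕ → ℕ → ℕ → Set
IsDiagonal b u v =
  1 ≤ u × u < v × v ≤ b + 1 × u + 2 ≤ v × ¬ ((u ≡ 1) × (v ≡ b + 1))

-- The diagonal {u,v} (u < v) separates i vertices from b-i-1 vertices.
-- The two sides contain v-u-1 and (b+1-v)+(u-1) vertices respectively.
Separates : ℕ → ℕ → ℕ → ℕ → Set
Separates b u v i =
  ((v ∸ u ∸ 1 ≡ i) × ((b + 1) ∸ v + (u ∸ 1) ≡ b ∸ i ∸ 1)) ⊎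
  ((v ∸ u ∸ 1 ≡ b ∸ i ∸ 1) × ((b + 1) ∸ v + (u ∸ 1) ≡ i))

InS : (a b : ℕ) → .{{NonZero a}} → ℕ → Set
InS a b i = ∃[ k ] (1 ≤ k × k < a × (k * b) / a ≡ i)

-- Let the laser from P = (x, y) end at Q, and let the lattice point before Q be (x + d, y + s).
-- That point lies strictly above the laser while Q = (x + d + 1, y + s) does not, so
-- a d < s b ≤ a (d + 1), and coprimality makes the second inequality strict: d = ⌊ s b / a ⌋ with
-- 0 < s < a (P is not on the x-axis and the path ends at height a). The diagonal e(P) separates d
-- vertices from b - 1 - d = ⌊ (a - s) b / a ⌋ vertices, so both sides lie in S(a,b). Conversely,
-- if d = ⌊ s b / a ⌋ and x + d < b, the path N^(a-s) E^x N^s E^(b-x) is an (a,b)-Dyck path whose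
-- laser from the corner (x, a - s) produces the diagonal between vertices x + 1 and x + d + 2.

module Submission where

open import Defs
open import Data.Nat using (ℕ; _<_; NonZero)
open import Data.Nat.Coprimality using (Coprime)
open import Function.Bundles using (_⇔_)

open import Data.Nat using (zero; suc; _+_; _*_; _∸_; _≤_; z≤n; s≤s; s≤s⁻¹; z<s; >-nonZero; >-nonZero⁻¹)
open import Data.Nat.Properties
open import Data.Nat.DivMod using (_/_; _%_; m≡m%n+[m/n]*n; m%n<n; m/n*n≤m; m<n*o⇒m/o<n; m*n/n≡m; /-monoˡ-≤)
open import Data.Nat.Divisibility using (divides; ∣⇒≤)
open import Data.Nat.Coprimality using (coprime-divisor)
open import Data.Nat.Tactic.RingSolver using (solve-∀)
open import Data.List using (List; []; _∷_; _++_; length; replicate)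
open import Data.List.Properties using (length-++; length-replicate; take-all; ++-identityʳ)
open import Data.Product using (_×_; _,_; proj₁; proj₂; ∃-syntax; ∃₂)
import Data.Product as Product
open import Data.Sum using (_⊎_; inj₁; inj₂)
import Data.Sum as Sum
open import Data.Empty using (⊥-elim)
open import Function using (_∘_; id)
open import Function.Bundles using (Equivalence; mk⇔)
open import Function.Construct.Composition using (_⇔-∘_)
open import Function.Construct.Identity using (⇔-id)
open import Function.Construct.Symmetry using (⇔-sym)
open import Relation.Binary.PropositionalEquality
open import Relation.Nullary using (¬_; yes; no)

private variable
  a b e i j k m n q r s u v w x y L : ℕ
  D : List Step

-- Floors and the set S(a,b)

n<a*[1+n/a] : ∀ n a .{{_ : NonZero a}} → n < a * suc (n / a)
n<a*[1+n/a] n a = begin-strict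
  n                 ≡⟨ m≡m%n+[m/n]*n n a ⟩
  n % a + n / a * a <⟨ +-monoˡ-< (n / a * a) (m%n<n n a) ⟩
  a + n / a * a     ≡⟨ *-comm (suc (n / a)) a ⟩
  a * suc (n / a)   ∎
  where open ≤-Reasoning

/-unique : .{{_ : NonZero a}} → a * q ≤ n → n < a * suc q → n / a ≡ q
/-unique {a} {q} {n} lo hi = ≤-antisym
  (s≤s⁻¹ (m<n*o⇒m/o<n (subst (n <_) (*-comm a (suc q)) hi)))
  (begin
    q         ≡⟨ m*n/n≡m q a ⟨
    q * a / a ≤⟨ /-monoˡ-≤ a (subst (_≤ n) (*-comm a q) lo) ⟩
    n / a     ∎)
  where open ≤-Reasoning

coprime⇒s*b≢a*q : Coprime a b → 0 < s → s < a → s * b ≢ a * q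
coprime⇒s*b≢a*q {a} {b} {s} {q} cop 0<s s<a sb≡aq = <⇒≱ s<a
  (∣⇒≤ {{>-nonZero 0<s}} (coprime-divisor cop (divides q (trans (*-comm b s) (trans sb≡aq (*-comm a q))))))

-- d = ⌊ s b / a ⌋, and s b / a is not an integer
StrictFloor : ℕ → ℕ → ℕ → ℕ → Set
StrictFloor a b s d = a * d < s * b × s * b < a * suc d

FloorValue : ℕ → ℕ → ℕ → Set
FloorValue a b i = ∃[ s ] (0 < s × s < a × StrictFloor a b s i)

InS⇔FloorValue : .{{_ : NonZero a}} → Coprime a b → InS a b i ⇔ FloorValue a b i
InS⇔FloorValue {a} {b} {i} cop = mk⇔ to from
  where
  to : InS a b i → FloorValue a b i
  to (s , 0<s , s<a , sb/a≡i) = s , 0<s , s<a , subst (StrictFloor a b s) sb/a≡i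
    ( ≤∧≢⇒< (subst (_≤ s * b) (*-comm _ a) (m/n*n≤m (s * b) a)) (coprime⇒s*b≢a*q cop 0<s s<a ∘ sym)
    , n<a*[1+n/a] (s * b) a )
  from : FloorValue a b i → InS a b i
  from (s , 0<s , s<a , lo , hi) = s , 0<s , s<a , /-unique (<⇒≤ lo) hi

m+n≡o+p∧m<o⇒p<n : ∀ {m n o p} → m + n ≡ o + p → m < o → p < n
m+n≡o+p∧m<o⇒p<n {m} {n} {o} {p} eq m<o with p <? n
... | yes p<n = p<n
... | no p≮n = ⊥-elim (<-irrefl eq (+-mono-<-≤ m<o (≮⇒≥ p≮n)))

strictFloor-complement : ∀ {s s′ d d′} → s + s′ ≡ a → suc (d + d′) ≡ b →
                         StrictFloor a b s d → StrictFloor a b s′ d′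
strictFloor-complement {a} {b} {s} {s′} {d} {d′} s+s′≡a 1+d+d′≡b (lo , hi) =
  m+n≡o+p∧m<o⇒p<n (sym total₂) hi , m+n≡o+p∧m<o⇒p<n total₁ lo
  where
  open ≡-Reasoning
  total : a * (d + suc d′) ≡ s * b + s′ * b
  total = begin
    a * (d + suc d′) ≡⟨ cong (a *_) (trans (+-suc d d′) 1+d+d′≡b) ⟩
    a * b            ≡⟨ cong (_* b) s+s′≡a ⟨
    (s + s′) * b     ≡⟨ *-distribʳ-+ b s s′ ⟩
    s * b + s′ * b   ∎
  total₁ : a * d + a * suc d′ ≡ s * b + s′ * b
  total₁ = trans (sym (*-distribˡ-+ a d (suc d′))) total
  total₂ : a * suc d + a * d′ ≡ s * b + s′ * b
  total₂ = trans (sym (*-distribˡ-+ a (suc d) d′)) (trans (cong (a *_) (sym (+-suc d d′))) total)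

floorValue-complement : suc (i + j) ≡ b → FloorValue a b i → FloorValue a b j
floorValue-complement {i} {j} {a = a} 1+i+j≡b (s , 0<s , s<a , fl) =
  a ∸ s , m<n⇒0<n∸m s<a , ∸-monoʳ-< {a} 0<s (<⇒≤ s<a) ,
  strictFloor-complement {s = s} {a ∸ s} {i} {j} (m+[n∸m]≡n (<⇒≤ s<a)) 1+i+j≡b fl

floorValue-complement⇔ : suc (i + j) ≡ b → FloorValue a b i ⇔ FloorValue a b j
floorValue-complement⇔ {i = i} {j = j} 1+i+j≡b = mk⇔ (floorValue-complement 1+i+j≡b)
  (floorValue-complement (trans (cong suc (+-comm j i)) 1+i+j≡b))

-- Lattice paths

posX-mono : ∀ D → k ≤ m → posX D k ≤ posX D m
posX-mono D       z≤n       = z≤n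
posX-mono []      (s≤s k≤m) = z≤n
posX-mono (N ∷ D) (s≤s k≤m) = posX-mono D k≤m
posX-mono (E ∷ D) (s≤s k≤m) = s≤s (posX-mono D k≤m)

posY-mono : ∀ D → k ≤ m → posY D k ≤ posY D m
posY-mono D       z≤n       = z≤n
posY-mono []      (s≤s k≤m) = z≤n
posY-mono (N ∷ D) (s≤s k≤m) = s≤s (posY-mono D k≤m)
posY-mono (E ∷ D) (s≤s k≤m) = posY-mono D k≤m

posY≤#N : ∀ D k → posY D k ≤ #N D
posY≤#N D       zero    = z≤n
posY≤#N []      (suc k) = z≤n
posY≤#N (N ∷ D) (suc k) = s≤s (posY≤#N D k)
posY≤#N (E ∷ D) (suc k) = posY≤#N D k

#N≡posY-length : ∀ D → #N D ≡ posY D (length D)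
#N≡posY-length D = cong #N (sym (take-all (length D) D ≤-refl))

#E≡posX-length : ∀ D → #E D ≡ posX D (length D)
#E≡posX-length D = cong #E (sym (take-all (length D) D ≤-refl))

pos-north : NorthAt D k → posX D (suc k) ≡ posX D k × posY D (suc k) ≡ suc (posY D k)
pos-north {[]}    {zero}  ()
pos-north {[]}    {suc k} ()
pos-north {N ∷ D} {zero}  refl = refl , refl
pos-north {E ∷ D} {zero}  ()
pos-north {N ∷ D} {suc k} north = Product.map id (cong suc) (pos-north {D} north)
pos-north {E ∷ D} {suc k} north = Product.map (cong suc) id (pos-north {D} north)

pos-east⊎pos-vertical : ∀ D k →
  (posX D (suc k) ≡ suc (posX D k) × posY D (suc k) ≡ posY D k) ⊎ posX D (suc k) ≡ posX D k
pos-east⊎pos-vertical []      zero    = inj₂ refl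
pos-east⊎pos-vertical []      (suc k) = inj₂ refl
pos-east⊎pos-vertical (N ∷ D) zero    = inj₂ refl
pos-east⊎pos-vertical (E ∷ D) zero    = inj₁ (refl , refl)
pos-east⊎pos-vertical (N ∷ D) (suc k) =
  Sum.map (Product.map id (cong suc)) id (pos-east⊎pos-vertical D k)
pos-east⊎pos-vertical (E ∷ D) (suc k) =
  Sum.map (Product.map (cong suc) id) (cong suc) (pos-east⊎pos-vertical D k)

-- Lasers

slope-≤⇔ : ∀ a b x y e s → b * (y + s) + a * x ≤ b * y + a * (x + e) ⇔ s * b ≤ a * e
slope-≤⇔ a b x y e s =
  mk⇔ (+-cancelˡ-≤ c _ _ ∘ subst₂ _≤_ (lhs a b x y s) (rhs a b x y e))
      (subst₂ _≤_ (sym (lhs a b x y s)) (sym (rhs a b x y e)) ∘ +-monoʳ-≤ c)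
  where
  c : ℕ
  c = b * y + a * x
  lhs : ∀ a b x y s → b * (y + s) + a * x ≡ (b * y + a * x) + s * b
  lhs = solve-∀
  rhs : ∀ a b x y e → b * y + a * (x + e) ≡ (b * y + a * x) + a * e
  rhs = solve-∀

onOrBelow⇔ : posX D k ≡ x → posY D k ≡ y → posX D m ≡ x + e → posY D m ≡ y + s →
             OnOrBelowLaser a b D k m ⇔ s * b ≤ a * e
onOrBelow⇔ {x = x} {y = y} {e = e} {s = s} {a} {b} Xk Yk Xm Ym rewrite Xk | Yk | Xm | Ym =
  slope-≤⇔ a b x y e s

onOrBelow-descend : posX D m ≡ posX D n → posY D m ≤ posY D n →
                    OnOrBelowLaser a b D k n → OnOrBelowLaser a b D k m
onOrBelow-descend {D} {m} {n} {a = a} {b} {k} Xm≡Xn Ym≤Yn below =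
  ≤-trans (+-monoˡ-≤ (a * posX D k) (*-monoʳ-≤ b Ym≤Yn))
          (subst (λ X → b * posY D n + a * posX D k ≤ b * posY D k + a * X) (sym Xm≡Xn) below)

laserPoint⇒0<posY : IsDyck a b D → LaserPoint D k → 0 < posY D k
laserPoint⇒0<posY {k = zero}  _                (_ , _ , notOrigin) = ⊥-elim (notOrigin (refl , refl))
laserPoint⇒0<posY {a} {b} {D} {suc k} (_ , _ , aboveLine) (k<len , _) = n≢0⇒n>0 λ y≡0 →
  <⇒≱ (aboveLine (suc k) z<s k<len)
      (subst (_≤ a * posX D (suc k)) (sym (trans (cong (b *_) y≡0) (*-zeroʳ b))) z≤n)

-- The laser cannot end on the north step at P since b > 0, and if its last step were not east,
-- the start of that step would already be on or below the laser.
laserEnd-east : 0 < b → NorthAt D k → LaserEnd a b D k (suc m) →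
                k < m × posX D (suc m) ≡ suc (posX D m) × posY D (suc m) ≡ posY D m
laserEnd-east {b} {D} {k} {a} {m} 0<b north (k<1+m , _ , below , before)
  with pos-north {D} {k} north | m≤n⇒m<n∨m≡n (s≤s⁻¹ k<1+m)
... | X , Y | inj₂ refl = ⊥-elim (<⇒≱ 0<b (subst₂ _≤_ (*-identityˡ b) (*-zeroʳ a) (Equivalence.to
  (onOrBelow⇔ {D} {k} {m = suc k} {e = 0} {s = 1} {a} {b} refl refl
     (trans X (sym (+-identityʳ _))) (trans Y (+-comm 1 _))) below)))
... | _ | inj₁ k<m with pos-east⊎pos-vertical D m
...   | inj₁ (X , Y) = k<m , X , Y
...   | inj₂ X = ⊥-elim (before m k<m (n<1+n m)
  (onOrBelow-descend {D} {m} {suc m} {a} {b} {k} (sym X) (posY-mono D (n≤1+n m)) below))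

laserEnd⇒strictFloor : 0 < b → Coprime a b → IsDyck a b D → LaserPoint D k → LaserEnd a b D k m →
  ∃₂ λ s d → 0 < s × s < a × StrictFloor a b s d × posX D m ≡ posX D k + suc d
laserEnd⇒strictFloor {m = zero} _ _ _ _ (() , _)
laserEnd⇒strictFloor {b} {a} {D} {k} {suc m} 0<b cop
                     dyck@(#N≡a , _) lp@(_ , north , _) end@(_ , _ , below , before)
  with laserEnd-east {a = a} 0<b north end
... | k<m , Xend , Yend
  with m≤n⇒∃[o]m+o≡n (posY-mono D k<m) | m≤n⇒∃[o]m+o≡n (posX-mono D (<⇒≤ k<m))
...   | s′ , Y₁+s′≡Ym | d , Xk+d≡Xm = suc s′ , d , z<s , s<a , (lo , hi) , Xend′
  where
  xP yP : ℕ
  xP = posX D k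
  yP = posY D k
  Ym : posY D m ≡ yP + suc s′
  Ym = trans (sym Y₁+s′≡Ym) (trans (cong (_+ s′) (proj₂ (pos-north {D} {k} north))) (sym (+-suc yP s′)))
  Xend′ : posX D (suc m) ≡ xP + suc d
  Xend′ = trans Xend (trans (cong suc (sym Xk+d≡Xm)) (sym (+-suc xP d)))
  s<a : suc s′ < a
  s<a = begin-strict
    suc s′         <⟨ m<n+m (suc s′) (laserPoint⇒0<posY dyck lp) ⟩
    yP + suc s′    ≡⟨ trans (sym Ym) (sym Yend) ⟩
    posY D (suc m) ≤⟨ posY≤#N D (suc m) ⟩
    #N D           ≡⟨ #N≡a ⟩
    a              ∎
    where open ≤-Reasoning
  lo : a * d < suc s′ * b
  lo = ≰⇒> λ s*b≤a*d → before m k<m (n<1+n m)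
    (Equivalence.from (onOrBelow⇔ {D} {k} {m = m} {a = a} {b} refl refl (sym Xk+d≡Xm) Ym) s*b≤a*d)
  hi : suc s′ * b < a * suc d
  hi = ≤∧≢⇒< (Equivalence.to (onOrBelow⇔ {D} {k} {m = suc m} {a = a} {b} refl refl Xend′ (trans Yend Ym))
                             below)
             (coprime⇒s*b≢a*q cop z<s s<a)

-- Paths with two corners

module _ (B : List Step) where

  posX-N^-prefix : k ≤ n → posX (replicate n N ++ B) k ≡ 0
  posX-N^-prefix z≤n       = refl
  posX-N^-prefix (s≤s k≤n) = posX-N^-prefix k≤n

  posY-N^-prefix : k ≤ n → posY (replicate n N ++ B) k ≡ k
  posY-N^-prefix z≤n       = refl
  posY-N^-prefix (s≤s k≤n) = cong suc (posY-N^-prefix k≤n)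

  posX-E^-prefix : k ≤ n → posX (replicate n E ++ B) k ≡ k
  posX-E^-prefix z≤n       = refl
  posX-E^-prefix (s≤s k≤n) = cong suc (posX-E^-prefix k≤n)

  posY-E^-prefix : k ≤ n → posY (replicate n E ++ B) k ≡ 0
  posY-E^-prefix z≤n       = refl
  posY-E^-prefix (s≤s k≤n) = posY-E^-prefix k≤n

  posX-N^-suffix : ∀ n k → posX (replicate n N ++ B) (n + k) ≡ posX B k
  posX-N^-suffix zero    k = refl
  posX-N^-suffix (suc n) k = posX-N^-suffix n k

  posY-N^-suffix : ∀ n k → posY (replicate n N ++ B) (n + k) ≡ n + posY B k
  posY-N^-suffix zero    k = refl
  posY-N^-suffix (suc n) k = cong suc (posY-N^-suffix n k)

  posX-E^-suffix : ∀ n k → posX (replicate n E ++ B) (n + k) ≡ n + posX B k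
  posX-E^-suffix zero    k = refl
  posX-E^-suffix (suc n) k = cong suc (posX-E^-suffix n k)

  posY-E^-suffix : ∀ n k → posY (replicate n E ++ B) (n + k) ≡ posY B k
  posY-E^-suffix zero    k = refl
  posY-E^-suffix (suc n) k = posY-E^-suffix n k

  northAt-N^ : 0 < n → NorthAt (replicate n N ++ B) 0
  northAt-N^ {suc n} _ = refl

  northAt-suffix : ∀ {s} n → NorthAt B k → NorthAt (replicate n s ++ B) (n + k)
  northAt-suffix zero    north = north
  northAt-suffix (suc n) north = northAt-suffix n north

posX-E^ : k ≤ n → posX (replicate n E) k ≡ k
posX-E^ {k} k≤n = subst (λ C → posX C k ≡ k) (++-identityʳ _) (posX-E^-prefix [] k≤n)

posY-E^ : k ≤ n → posY (replicate n E) k ≡ 0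
posY-E^ {k} k≤n = subst (λ C → posY C k ≡ 0) (++-identityʳ _) (posY-E^-prefix [] k≤n)

cornerPath : ℕ → ℕ → ℕ → ℕ → List Step
cornerPath p x t q = replicate p N ++ replicate x E ++ replicate t N ++ replicate q E

k≤n⊎k≡n+r : ∀ n k → k ≤ n ⊎ ∃[ r ] k ≡ n + r
k≤n⊎k≡n+r zero    k       = inj₂ (k , refl)
k≤n⊎k≡n+r (suc n) zero    = inj₁ z≤n
k≤n⊎k≡n+r (suc n) (suc k) = Sum.map s≤s (Product.map₂ (cong suc)) (k≤n⊎k≡n+r n k)

module CornerPath {a b p x t q : ℕ} (p+t≡a : p + t ≡ a) (x+q≡b : x + q ≡ b) where

  path : List Step
  path = cornerPath p x t q

  length-path : length path ≡ p + (x + (t + q))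
  length-path =
    trans (length-++ (replicate p N)) (cong₂ _+_ (length-replicate p)
    (trans (length-++ (replicate x E)) (cong₂ _+_ (length-replicate x)
    (trans (length-++ (replicate t N)) (cong₂ _+_ (length-replicate t) (length-replicate q))))))

  data CornerPoint : ℕ → Set where
    rise₁ : ∀ r → r ≤ p → CornerPoint r
    run₁  : ∀ r → r ≤ x → CornerPoint (p + r)
    rise₂ : ∀ r → r ≤ t → CornerPoint (p + (x + r))
    run₂  : ∀ r → r ≤ q → CornerPoint (p + (x + (t + r)))

  cornerPoint : k ≤ p + (x + (t + q)) → CornerPoint k
  cornerPoint {k} k≤len with k≤n⊎k≡n+r p k
  ... | inj₁ k≤p = rise₁ k k≤p
  ... | inj₂ (r₁ , refl) with k≤n⊎k≡n+r x r₁
  ...   | inj₁ r₁≤x = run₁ r₁ r₁≤x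
  ...   | inj₂ (r₂ , refl) with k≤n⊎k≡n+r t r₂
  ...     | inj₁ r₂≤t = rise₂ r₂ r₂≤t
  ...     | inj₂ (r₃ , refl) = run₂ r₃ (+-cancelˡ-≤ t _ _ (+-cancelˡ-≤ x _ _ (+-cancelˡ-≤ p _ _ k≤len)))

  pos-rise₁ : r ≤ p → posX path r ≡ 0 × posY path r ≡ r
  pos-rise₁ r≤p = posX-N^-prefix _ r≤p , posY-N^-prefix _ r≤p

  pos-run₁ : r ≤ x → posX path (p + r) ≡ r × posY path (p + r) ≡ p
  pos-run₁ {r} r≤x =
    trans (posX-N^-suffix _ p r) (posX-E^-prefix _ r≤x) ,
    trans (posY-N^-suffix _ p r) (trans (cong (p +_) (posY-E^-prefix _ r≤x)) (+-identityʳ p))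

  pos-rise₂ : r ≤ t → posX path (p + (x + r)) ≡ x × posY path (p + (x + r)) ≡ p + r
  pos-rise₂ {r} r≤t =
    trans (posX-N^-suffix _ p (x + r)) (trans (posX-E^-suffix _ x r)
      (trans (cong (x +_) (posX-N^-prefix _ r≤t)) (+-identityʳ x))) ,
    trans (posY-N^-suffix _ p (x + r)) (cong (p +_) (trans (posY-E^-suffix _ x r) (posY-N^-prefix _ r≤t)))

  pos-run₂ : r ≤ q → posX path (p + (x + (t + r))) ≡ x + r × posY path (p + (x + (t + r))) ≡ p + t
  pos-run₂ {r} r≤q =
    trans (posX-N^-suffix _ p _) (trans (posX-E^-suffix _ x _)
      (cong (x +_) (trans (posX-N^-suffix _ t r) (posX-E^ r≤q)))) ,
    trans (posY-N^-suffix _ p _) (cong (p +_) (trans (posY-E^-suffix _ x _)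
      (trans (posY-N^-suffix _ t r) (trans (cong (t +_) (posY-E^ r≤q)) (+-identityʳ t)))))

  cornerPath-dyck : 0 < a → 0 < b → a * x < b * p → IsDyck a b path
  cornerPath-dyck 0<a 0<b corner = #N≡a , #E≡b , aboveLine
    where
    end : posX path (p + (x + (t + q))) ≡ x + q × posY path (p + (x + (t + q))) ≡ p + t
    end = pos-run₂ {q} ≤-refl
    #N≡a : #N path ≡ a
    #N≡a = trans (#N≡posY-length path) (trans (cong (posY path) length-path) (trans (proj₂ end) p+t≡a))
    #E≡b : #E path ≡ b
    #E≡b = trans (#E≡posX-length path) (trans (cong (posX path) length-path) (trans (proj₁ end) x+q≡b))
    at : ∀ k {X Y} → posX path k ≡ X × posY path k ≡ Y → a * X < b * Y → a * posX path k < b * posY path k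
    at _ (X≡ , Y≡) rewrite X≡ | Y≡ = id
    aboveLine : ∀ k → 0 < k → k < length path → a * posX path k < b * posY path k
    aboveLine k 0<k k<len with cornerPoint (<⇒≤ (subst (k <_) length-path k<len))
    ... | rise₁ r r≤p = at r (pos-rise₁ r≤p)
      (subst (_< b * r) (sym (*-zeroʳ a)) (≤-trans 0<b (m≤m*n b r {{>-nonZero 0<k}})))
    ... | run₁ r r≤x = at (p + r) (pos-run₁ r≤x) (≤-<-trans (*-monoʳ-≤ a r≤x) corner)
    ... | rise₂ r r≤t = at (p + (x + r)) (pos-rise₂ r≤t) (<-≤-trans corner (*-monoʳ-≤ b (m≤m+n p r)))
    ... | run₂ r r≤q = at (p + (x + (t + r))) (pos-run₂ r≤q) (begin-strict
      a * (x + r) <⟨ *-monoʳ-< a {{>-nonZero 0<a}} (+-monoʳ-< x r<q) ⟩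
      a * (x + q) ≡⟨ cong (a *_) x+q≡b ⟩
      a * b       ≡⟨ *-comm a b ⟩
      b * a       ≡⟨ cong (b *_) p+t≡a ⟨
      b * (p + t) ∎)
      where
      open ≤-Reasoning
      r<q : r < q
      r<q = +-cancelˡ-< t _ _ (+-cancelˡ-< x _ _ (+-cancelˡ-< p _ _ (subst (_ <_) length-path k<len)))

  cornerPath-laserPoint : 0 < p → 0 < t → LaserPoint path (p + x)
  cornerPath-laserPoint 0<p 0<t =
    subst (p + x <_) (sym length-path) (+-monoʳ-< p (m<m+n x (≤-trans 0<t (m≤m+n t q)))) ,
    subst (NorthAt path) (cong (p +_) (+-identityʳ x))
      (northAt-suffix _ p (northAt-suffix _ x (northAt-N^ _ 0<t))) ,
    λ (_ , y≡0) → <⇒≢ 0<p (sym (trans (sym (proj₂ (pos-run₁ {x} ≤-refl))) y≡0))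

  cornerPath-laserEnd : 0 < b → 0 < t → StrictFloor a b t L → suc L ≤ q →
                        LaserEnd a b path (p + x) (p + (x + (t + suc L)))
  cornerPath-laserEnd {L} 0<b 0<t (lo , hi) 1+L≤q = k<Q , Q≤len , below , before
    where
    Q : ℕ
    Q = p + (x + (t + suc L))
    P : posX path (p + x) ≡ x × posY path (p + x) ≡ p
    P = pos-run₁ ≤-refl
    k<Q : p + x < Q
    k<Q = +-monoʳ-< p (m<m+n x (≤-trans 0<t (m≤m+n t (suc L))))
    Q≤len : Q ≤ length path
    Q≤len = subst (Q ≤_) (sym length-path) (+-monoʳ-≤ p (+-monoʳ-≤ x (+-monoʳ-≤ t 1+L≤q)))
    slope : ∀ n {e s} → posX path n ≡ x + e × posY path n ≡ p + s →
            OnOrBelowLaser a b path (p + x) n ⇔ s * b ≤ a * e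
    slope n (X≡ , Y≡) = onOrBelow⇔ {path} {p + x} {m = n} {a = a} {b} (proj₁ P) (proj₂ P) X≡ Y≡
    below : OnOrBelowLaser a b path (p + x) Q
    below = Equivalence.from (slope Q (pos-run₂ 1+L≤q)) (<⇒≤ hi)
    before : ∀ m′ → p + x < m′ → m′ < Q → ¬ OnOrBelowLaser a b path (p + x) m′
    before m′ k<m′ m′<Q with cornerPoint (≤-trans (<⇒≤ m′<Q) (subst (Q ≤_) length-path Q≤len))
    ... | rise₁ r r≤p = λ _ → <⇒≱ k<m′ (≤-trans r≤p (m≤m+n p x))
    ... | run₁ r r≤x = λ _ → <⇒≱ k<m′ (+-monoʳ-≤ p r≤x)
    ... | rise₂ r r≤t = λ below′ → <⇒≱ (≤-trans 0<b (m≤n*m b r {{>-nonZero 0<r}}))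
      (subst (r * b ≤_) (*-zeroʳ a) (Equivalence.to (slope (p + (x + r)) R) below′))
      where
      R : posX path (p + (x + r)) ≡ x + 0 × posY path (p + (x + r)) ≡ p + r
      R = Product.map₁ (λ X≡ → trans X≡ (sym (+-identityʳ x))) (pos-rise₂ r≤t)
      0<r : 0 < r
      0<r = +-cancelˡ-< x 0 r (subst (_< x + r) (sym (+-identityʳ x)) (+-cancelˡ-< p _ _ k<m′))
    ... | run₂ r r≤q = λ below′ → <⇒≱ lo
      (≤-trans (Equivalence.to (slope (p + (x + (t + r))) (pos-run₂ r≤q)) below′) (*-monoʳ-≤ a r≤L))
      where
      r≤L : r ≤ L
      r≤L = s≤s⁻¹ (+-cancelˡ-< t _ _ (+-cancelˡ-< x _ _ (+-cancelˡ-< p _ _ m′<Q)))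

  cornerPath-assVertex : 0 < a → 0 < b → 0 < p → 0 < t → StrictFloor a b t L → suc L ≤ q →
                         IsAssVertex a b (suc x) (suc (suc (x + L)))
  cornerPath-assVertex {L} 0<a 0<b 0<p 0<t (lo , hi) 1+L≤q =
    path , cornerPath-dyck 0<a 0<b corner , p + x , p + (x + (t + suc L)) ,
    cornerPath-laserPoint 0<p 0<t , cornerPath-laserEnd 0<b 0<t (lo , hi) 1+L≤q ,
    inj₁ ( sym (trans (cong (_+ 1) (proj₁ (pos-run₁ {x} ≤-refl))) (+-comm x 1))
         , sym (trans (cong (_+ 1) (proj₁ (pos-run₂ 1+L≤q)))
                      (trans (+-comm (x + suc L) 1) (cong suc (+-suc x L)))))
    where
    corner : a * x < b * p
    corner = +-cancelʳ-< (t * b) (a * x) (b * p) (begin-strict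
      a * x + t * b     <⟨ +-monoʳ-< (a * x) hi ⟩
      a * x + a * suc L ≡⟨ *-distribˡ-+ a x (suc L) ⟨
      a * (x + suc L)   ≤⟨ *-monoʳ-≤ a (+-monoʳ-≤ x 1+L≤q) ⟩
      a * (x + q)       ≡⟨ cong (a *_) x+q≡b ⟩
      a * b             ≡⟨ cong (_* b) p+t≡a ⟨
      (p + t) * b       ≡⟨ *-distribʳ-+ b p t ⟩
      p * b + t * b     ≡⟨ cong (_+ t * b) (*-comm p b) ⟩
      b * p + t * b     ∎)
      where open ≤-Reasoning

-- Vertices of Ass(a,b)

sameDiagonal-ordered : i < j → u < v → SameDiagonal i j u v → u ≡ i + 1 × v ≡ j + 1
sameDiagonal-ordered _   _   (inj₁ ends) = ends
sameDiagonal-ordered {i} {j} i<j u<v (inj₂ (u≡j+1 , v≡i+1)) =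
  ⊥-elim (<-asym i<j (+-cancelʳ-< 1 j i (subst₂ _<_ u≡j+1 v≡i+1 u<v)))

assVertex⇔floorValue : 0 < a → 0 < b → Coprime a b → suc (x + L) ≤ b →
                       IsAssVertex a b (suc x) (suc (suc (x + L))) ⇔ FloorValue a b L
assVertex⇔floorValue {a} {b} {x} {L} 0<a 0<b cop 1+x+L≤b = mk⇔ to from
  where
  to : IsAssVertex a b (suc x) (suc (suc (x + L))) → FloorValue a b L
  to (D , dyck , k , m , lp , end , same)
    with laserEnd⇒strictFloor 0<b cop dyck lp end
  ... | s , d , 0<s , s<a , fl , Xm = s , 0<s , s<a , subst (StrictFloor a b s) (sym L≡d) fl
    where
    open ≡-Reasoning
    ends : suc x ≡ posX D k + 1 × suc (suc (x + L)) ≡ posX D m + 1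
    ends = sameDiagonal-ordered (subst (posX D k <_) (sym Xm) (m<m+n _ z<s))
                                (s≤s (s≤s (m≤m+n x L))) same
    L≡d : L ≡ d
    L≡d = +-cancelˡ-≡ x L d (suc-injective (begin
      suc (x + L)      ≡⟨ suc-injective (trans (proj₂ ends) (+-comm _ 1)) ⟩
      posX D m         ≡⟨ Xm ⟩
      posX D k + suc d ≡⟨ cong (_+ suc d) (suc-injective (trans (proj₁ ends) (+-comm _ 1))) ⟨
      x + suc d        ≡⟨ +-suc x d ⟩
      suc (x + d)      ∎))
  from : FloorValue a b L → IsAssVertex a b (suc x) (suc (suc (x + L)))
  from (s , 0<s , s<a , fl) =
    CornerPath.cornerPath-assVertex (m∸n+n≡m (<⇒≤ s<a)) (m+[n∸m]≡n x≤b)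
      0<a 0<b (m<n⇒0<n∸m s<a) 0<s fl 1+L≤b∸x
    where
    x≤b : x ≤ b
    x≤b = ≤-trans (m≤m+n x L) (≤-trans (n≤1+n _) 1+x+L≤b)
    1+L≤b∸x : suc L ≤ b ∸ x
    1+L≤b∸x = +-cancelˡ-≤ x _ _ (subst₂ _≤_ (sym (+-suc x L)) (sym (m+[n∸m]≡n x≤b)) 1+x+L≤b)

floorValue-side : suc (L + j) ≡ b → L ≡ i ⊎ j ≡ i → FloorValue a b L ⇔ FloorValue a b i
floorValue-side {L} {b = b} {a = a} _ (inj₁ refl) = ⇔-id (FloorValue a b L)
floorValue-side 1+L+j≡b (inj₂ refl) = floorValue-complement⇔ 1+L+j≡b

separates-sides : suc (suc (x + L)) + w ≡ b + 1 → Separates b (suc x) (suc (suc (x + L))) i →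
                  L ≡ i ⊎ w + x ≡ i
separates-sides {x} {L} {w} {b} v+w≡b+1 =
  Sum.map (trans (sym inner) ∘ proj₁) (trans (sym outer) ∘ proj₂)
  where
  inner : suc (suc (x + L)) ∸ suc x ∸ 1 ≡ L
  inner = cong (_∸ 1) (trans (cong (_∸ x) (sym (+-suc x L))) (m+n∸m≡n x (suc L)))
  outer : (b + 1) ∸ suc (suc (x + L)) + (suc x ∸ 1) ≡ w + x
  outer = cong (_+ x)
    (trans (cong (_∸ suc (suc (x + L))) (sym v+w≡b+1)) (m+n∸m≡n (suc (suc (x + L))) w))

proposition4p3 : (a b : ℕ) → .{{_ : NonZero a}} → a < b → Coprime a b →
    (u v : ℕ) → IsDiagonal b u v → (i : ℕ) → Separates b u v i →
    (IsAssVertex a b u v ⇔ InS a b i)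
proposition4p3 a b a<b cop zero    v (() , _) i sep
proposition4p3 a b a<b cop (suc x) v (_ , u<v , v≤b+1 , _) i sep
  with m≤n⇒∃[o]m+o≡n u<v | m≤n⇒∃[o]m+o≡n v≤b+1
... | L , refl | w , v+w≡b+1 =
  ⇔-sym (InS⇔FloorValue cop)
    ⇔-∘ (floorValue-side 1+L+w+x≡b (separates-sides v+w≡b+1 sep)
    ⇔-∘ assVertex⇔floorValue (>-nonZero⁻¹ a) (m<n⇒0<n a<b) cop 1+x+L≤b)
  where
  1+L+w+x≡b : suc (L + (w + x)) ≡ b
  1+L+w+x≡b = +-cancelʳ-≡ 1 _ _ (trans (sides x L w) v+w≡b+1)
    where
    sides : ∀ x L w → suc (L + (w + x)) + 1 ≡ suc (suc (x + L)) + w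
    sides = solve-∀
  1+x+L≤b : suc (x + L) ≤ b
  1+x+L≤b = subst (suc (x + L) ≤_) 1+L+w+x≡b
    (s≤s (subst (_≤ L + (w + x)) (+-comm L x) (+-monoʳ-≤ L (m≤n+m x w))))
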